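{- Let $T\subseteq\omega^{<\omega}$ be a tree and $\mathcal{A}(T)=(G,(f_a)_{a\in G})$ the associated structure. Let $\overline{a}=(a_1,\dots,a_k)$ and $\overline{b}=(b_1,\dots,b_k)$ be tuples in $\mathcal{A}(T)$ with $\overline{a}\equiv^0\overline{b}$. Let $n$ be greatest such that some $a_i$ lies in $G_n$, fix such an $i$, and let $g=f_{a_i}(b_i)$. Then for every ordinal $\beta$ the following are equivalent: (1) $\overline{a}\equiv^\beta\overline{b}$; (2) $\overline{a},id_n\equiv^\beta\overline{b},g$; (3) $id_n\equiv^\beta g$.
   Context: For a tree $T\subseteq\omega^{<\omega}$ let $T_n$ be the set of nodes of length $n$. $G_n$ is the set of finite subsets of $T_n$, an abelian group under symmetric difference $\triangle$; for distinct $n>0$ the empty set in $G_n$ is replaced by distinct new elements $id_n$, and $G_0=\{id_0\}$. $G=\bigcup_n G_n$. The predecessor map $p:G_{n+1}\to G_n$: for nonempty $a=\{t_1,\dots,t_k\}\in G_{n+1}$ with $t_j'$ the predecessor of $t_j$ in $T$, $p(a)=\{t_1'\}\triangle\cdots\triangle\{t_k'\}$ (with $\emptyset$ written $id_n$), and $p(id_{n+1})=id_n$. For $a\in G_n$, $b\in G_m$, let $k=\min\{m,n\}$, $a^*=p^{(n-k)}(a)$, $b^*=p^{(m-k)}(b)$, and $f_a(b)=a^*\triangle b^*$. $\mathcal{A}(T)=(G,(f_a)_{a\in G})$. Back-and-forth relations: $\overline{a}\equiv^0\overline{b}$ iff the tuples satisfy the same quantifier-free formulas; for $\beta>0$, $\overline{a}\equiv^\beta\overline{b}$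 iff for every $\gamma<\beta$, for every $c$ there is $d$ and for every $d$ there is $c$ with $\overline{a},c\equiv^\gamma\overline{b},d$. -}

module Defs where

open import Data.Nat using (ℕ; zero; suc; _⊓_; _∸_; _≤_)
open import Data.Nat.Properties using () renaming (_≟_ to _≟ℕ_)
open import Data.Bool using (Bool; true; false; not; if_then_else_)
open import Data.List using (List; []; _∷_; _++_; map; length; _∷ʳ_)
open import Data.List.Properties using (≡-dec)
open import Data.List.Relation.Unary.All using (All)
open import Data.Vec using (Vec; lookup)
open import Data.Vec renaming (_∷ʳ_ to _∷ᵛ_) using ()
open import Data.Fin using (Fin)
open import Data.Product using (Σ; _×_)
open import Data.Empty using (⊥)
open import Relation.Nullary using (¬_; does)
open import Relation.Binary.Core using (Rel)
open import Relation.Binary.PropositionalEquality using (_≡_)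
open import Induction.WellFounded using (Acc; acc)
open import Level using (0ℓ)

Node : Set
Node = List ℕ

IsTree : (Node → Set) → Set
IsTree T = ∀ (s : Node) (x : ℕ) → T (s ∷ʳ x) → T s

parent : Node → Node
parent [] = []
parent (x ∷ []) = []
parent (x ∷ y ∷ l) = x ∷ parent (y ∷ l)

-- Raw elements: a level n and a finite list of nodes; the list represents the
-- finite subset of nodes occurring an ODD number of times (so symmetric
-- difference is concatenation).
record Elem : Set where
  constructor mk
  field
    lvl   : ℕ
    nodes : List Node
open Elem public

Valid : (Node → Set) → Elem → Set
Valid T a = All (λ t → T t × (length t ≡ lvl a)) (nodes a) × (lvl a ≡ 0 → nodes a ≡ [])

odd : Node → List Node → Bool
odd s [] = false
odd s (t ∷ ts) = if does (≡-dec _≟ℕ_ s t) then not (odd s ts) else odd s ts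

_≈_ : Elem → Elem → Set
a ≈ b = (lvl a ≡ lvl b) × (∀ s → odd s (nodes a) ≡ odd s (nodes b))

idE : ℕ → Elem
idE n = mk n []

p : Elem → Elem
p (mk zero xs) = mk zero []
p (mk (suc zero) xs) = mk zero []
p (mk (suc (suc n)) xs) = mk (suc n) (map parent xs)

iter : ℕ → Elem → Elem
iter zero a = a
iter (suc j) a = p (iter j a)

f : Elem → Elem → Elem
f a b = mk k (nodes (iter (lvl a ∸ k) a) ++ nodes (iter (lvl b ∸ k) b))
  where k = lvl a ⊓ lvl b

data Term (T : Node → Set) (k : ℕ) : Set where
  var : Fin k → Term T k
  app : (a : Elem) → Valid T a → Term T k → Term T k

data QF (T : Node → Set) (k : ℕ) : Set where
  eq  : Term T k → Term T k → QF T k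
  neg : QF T k → QF T k
  and : QF T k → QF T k → QF T k
  or  : QF T k → QF T k → QF T k

eval : ∀ {T k} → Vec Elem k → Term T k → Elem
eval as (var i) = lookup as i
eval as (app a _ t) = f a (eval as t)

Sat : ∀ {T k} → Vec Elem k → QF T k → Set
Sat as (eq t u) = eval as t ≈ eval as u
Sat as (neg φ) = ¬ Sat as φ
Sat as (and φ ψ) = Sat as φ × Sat as ψ
Sat as (or φ ψ) = Data.Sum._⊎_ (Sat as φ) (Sat as ψ)
  where import Data.Sum

BF0 : (T : Node → Set) → ∀ {k} → Vec Elem k → Vec Elem k → Set
BF0 T {k} as bs = ∀ (φ : QF T k) → (Sat as φ → Sat bs φ) × (Sat bs φ → Sat as φ)

-- ≡^β, by well-founded recursion on β in a well-order (O , _<_).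
-- β = 0 (no γ < β): ≡^0.  β > 0: back-and-forth for every γ < β.
BF : (T : Node → Set) (O : Set) (_<_ : Rel O 0ℓ) (β : O) → Acc _<_ β →
     ∀ {k} → Vec Elem k → Vec Elem k → Set
BF T O _<_ β (acc rs) as bs =
  ((∀ γ → ¬ (γ < β)) → BF0 T as bs) ×
  (∀ γ (h : γ < β) →
     (∀ c → Valid T c → Σ Elem λ d → Valid T d × BF T O _<_ γ (rs h) (as ∷ᵛ c) (bs ∷ᵛ d)) ×
     (∀ d → Valid T d → Σ Elem λ c → Valid T c × BF T O _<_ γ (rs h) (as ∷ᵛ c) (bs ∷ᵛ d)))

{-# OPTIONS --safe #-}
module Submission where

-- For g ∈ G_N, translation by g sends x (of level ≤ N) to x △ g', where g' is the image of g
-- in the level of x. It commutes with every f_a and is injective on each level, so it preserves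
-- quantifier-free formulas. Conversely, if ā ≡^0 b̄ and a_i has maximal level N, then applying
-- ≡^0 to f_{a_i}(a_j) = f_{a_j}(a_i) shows that b̄ is the translate of ā by g = f_{a_i}(b_i).
-- Hence ≡^β between two tuples depends only on the translation relating them, provided its
-- level is attained on the left: in a back-and-forth step the extended pair is related by a
-- new translation g⁺, which agrees with g up to level N because both send a_i to b_i, and so
-- g⁺ also relates the other extended pair. The three pairs in the statement are all related
-- by g.

open import Defs
open import Data.Nat using (ℕ; suc; _≤_)
open import Data.Fin using (Fin)
open import Data.Vec using (Vec; lookup; [_]) renaming (_∷ʳ_ to _∷ᵛ_)
open import Data.Product using (_×_)
open import Function.Bundles using (_⇔_)
open import Relation.Binary.Core using (Rel)
open import Relation.Binary.Structures using (IsStrictTotalOrder)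
open import Relation.Binary.PropositionalEquality using (_≡_)
open import Induction.WellFounded using (WellFounded)
open import Level using (0ℓ)

open import Data.Bool using (Bool; true; false; not; _xor_)
open import Data.Bool.Properties
  using (xor-assoc; xor-comm; xor-same; xor-identityʳ; not-injective; not-distribʳ-xor; not-involutive)
  renaming (_≟_ to _≟ᵇ_)
open import Data.Fin using (zero; suc; inject₁; fromℕ)
open import Data.List using (List; []; _∷_; _++_; map; foldr; length)
open import Data.List.Membership.Propositional using (_∈_)
open import Data.List.Membership.Propositional.Properties using (∈-∃++)
open import Data.List.Properties using (≡-dec; ++-assoc; map-++; length-++-sucʳ)
open import Data.List.Relation.Unary.All using ([])
open import Data.List.Relation.Unary.Any using (here; there)
open import Data.Nat using (zero; pred; _⊓_; _∸_; _+_; _<_; s≤s; _≤?_)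
open import Data.Nat.Induction using (<-wellFounded)
open import Data.Nat.Properties
  using (≤-refl; ≤-trans; ≤-reflexive; ≤-antisym; n≤1+n; <⇒≤; ≰⇒>; m⊓n≤m; m⊓n≤n; ⊓-comm; ⊓-glb; ⊓-idem;
         m≥n⇒m⊓n≡n; m≤n⇒m∸n≡0; m∸n≤m; m∸[m∸n]≡n; m∸n+n≡m; +-∸-assoc; +-comm; pred[m∸n]≡m∸[1+n])
  renaming (_≟_ to _≟ℕ_)
open import Data.Product using (∃-syntax; _,_; proj₁; proj₂)
open import Data.Product.Function.NonDependent.Propositional using (_×-⇔_)
open import Data.Sum.Function.Propositional using (_⊎-⇔_)
open import Data.Vec using ([]; _∷_)
open import Function.Base using (_∘_; _on_)
open import Function.Bundles using (mk⇔; Equivalence)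
open import Function.Construct.Composition using (_⇔-∘_)
open import Function.Construct.Symmetry using (⇔-sym)
open import Function.Related.TypeIsomorphisms using (¬-cong-⇔)
open import Induction.WellFounded using (Acc; acc)
open import Relation.Binary.Bundles using (Setoid)
open import Relation.Binary.Construct.On using (wellFounded)
open import Relation.Binary.PropositionalEquality
  using (refl; sym; trans; cong; cong₂; subst; module ≡-Reasoning)
import Relation.Binary.Reasoning.Setoid as SetoidReasoning
open import Relation.Binary.Structures using (IsEquivalence)
open import Relation.Nullary using (¬_; does; yes; no)
open import Relation.Nullary.Decidable using (dec-true; decidable-stable)
open import Relation.Nullary.Negation using (Stable; ¬¬-map)

open Equivalence using (to; from)

private
  variable
    k : ℕ
    A B : Set

xor-cancelˡ : ∀ a b → a xor (a xor b) ≡ b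
xor-cancelˡ a b = trans (sym (xor-assoc a a b)) (cong (_xor b) (xor-same a))

xor-pair : ∀ a b c → a xor (b xor (a xor c)) ≡ b xor c
xor-pair false b c = refl
xor-pair true  b c = trans (not-distribʳ-xor b (not c)) (cong (b xor_) (not-involutive c))

xor-exchange : ∀ a b x y → a xor y ≡ b xor x → y ≡ x xor (a xor b)
xor-exchange a b x y e = begin
  y                 ≡⟨ xor-cancelˡ a y ⟨
  a xor (a xor y)   ≡⟨ cong (a xor_) e ⟩
  a xor (b xor x)   ≡⟨ xor-assoc a b x ⟨
  (a xor b) xor x   ≡⟨ xor-comm (a xor b) x ⟩
  x xor (a xor b)   ∎
  where open ≡-Reasoning

parity : (A → Bool) → List A → Bool
parity P = foldr (λ t b → P t xor b) false

parity-++ : ∀ (P : A → Bool) xs ys → parity P (xs ++ ys) ≡ parity P xs xor parity P ys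
parity-++ P []       ys = refl
parity-++ P (x ∷ xs) ys = trans (cong (P x xor_) (parity-++ P xs ys)) (sym (xor-assoc (P x) _ _))

parity-map : ∀ (P : B → Bool) (h : A → B) xs → parity P (map h xs) ≡ parity (P ∘ h) xs
parity-map P h []       = refl
parity-map P h (x ∷ xs) = cong (P (h x) xor_) (parity-map P h xs)

parity-pair : ∀ (P : A → Bool) u l₁ l₂ → parity P (u ∷ l₁ ++ u ∷ l₂) ≡ parity P (l₁ ++ l₂)
parity-pair P u l₁ l₂ = begin
  P u xor parity P (l₁ ++ u ∷ l₂)                  ≡⟨ cong (P u xor_) (parity-++ P l₁ (u ∷ l₂)) ⟩
  P u xor (parity P l₁ xor (P u xor parity P l₂))  ≡⟨ xor-pair (P u) (parity P l₁) (parity P l₂) ⟩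
  parity P l₁ xor parity P l₂                      ≡⟨ parity-++ P l₁ l₂ ⟨
  parity P (l₁ ++ l₂)                              ∎
  where open ≡-Reasoning

_==_ : Node → Node → Bool
s == t = does (≡-dec _≟ℕ_ s t)

odd≡parity : ∀ s xs → odd s xs ≡ parity (s ==_) xs
odd≡parity s []       = refl
odd≡parity s (t ∷ ts) with s == t
... | true  = cong not (odd≡parity s ts)
... | false = odd≡parity s ts

odd-++ : ∀ s xs ys → odd s (xs ++ ys) ≡ odd s xs xor odd s ys
odd-++ s xs ys = begin
  odd s (xs ++ ys)                          ≡⟨ odd≡parity s (xs ++ ys) ⟩
  parity (s ==_) (xs ++ ys)                 ≡⟨ parity-++ (s ==_) xs ys ⟩
  parity (s ==_) xs xor parity (s ==_) ys   ≡⟨ cong₂ _xor_ (odd≡parity s xs) (odd≡parity s ys) ⟨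
  odd s xs xor odd s ys                     ∎
  where open ≡-Reasoning

odd-self-∷ : ∀ u zs → odd u (u ∷ zs) ≡ not (odd u zs)
odd-self-∷ u zs rewrite dec-true (≡-dec _≟ℕ_ u u) refl = refl

odd⇒∈ : ∀ {s} xs → odd s xs ≡ true → s ∈ xs
odd⇒∈ {s} (t ∷ ts) e with ≡-dec _≟ℕ_ s t
... | yes s≡t = here s≡t
... | no  _   = there (odd⇒∈ ts e)

-- Equality of the finite sets represented by two lists; a record, so that its arguments
-- can be inferred.
infix 4 _~_
record _~_ (xs ys : List Node) : Set where
  constructor mk~
  field odd-≡ : ∀ s → odd s xs ≡ odd s ys
open _~_

~-sym : ∀ {xs ys} → xs ~ ys → ys ~ xs
~-sym e = mk~ λ s → sym (odd-≡ e s)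

~-trans : ∀ {xs ys zs} → xs ~ ys → ys ~ zs → xs ~ zs
~-trans e e′ = mk~ λ s → trans (odd-≡ e s) (odd-≡ e′ s)

pair-~ : ∀ u l₁ l₂ → u ∷ l₁ ++ u ∷ l₂ ~ l₁ ++ l₂
pair-~ u l₁ l₂ = mk~ λ s → begin
  odd s (u ∷ l₁ ++ u ∷ l₂)            ≡⟨ odd≡parity s (u ∷ l₁ ++ u ∷ l₂) ⟩
  parity (s ==_) (u ∷ l₁ ++ u ∷ l₂)   ≡⟨ parity-pair (s ==_) u l₁ l₂ ⟩
  parity (s ==_) (l₁ ++ l₂)           ≡⟨ odd≡parity s (l₁ ++ l₂) ⟨
  odd s (l₁ ++ l₂)                    ∎
  where open ≡-Reasoning

head-reoccurs : ∀ {u zs} → u ∷ zs ~ [] → u ∈ zs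
head-reoccurs {u} {zs} e = odd⇒∈ zs (not-injective (trans (sym (odd-self-∷ u zs)) (odd-≡ e u)))

parity-even : ∀ (P : Node → Bool) zs → zs ~ [] → parity P zs ≡ false
parity-even P zs = go zs (wellFounded length <-wellFounded zs)
  where
  go : ∀ zs → Acc (_<_ on length) zs → zs ~ [] → parity P zs ≡ false
  go []       _        _ = refl
  go (u ∷ zs) (acc rs) e with ∈-∃++ (head-reoccurs e)
  ... | l₁ , l₂ , refl =
    trans (parity-pair P u l₁ l₂) (go (l₁ ++ l₂) (rs shorter) (~-trans (~-sym (pair-~ u l₁ l₂)) e))
    where
    shorter : length (l₁ ++ l₂) < length (u ∷ l₁ ++ u ∷ l₂)
    shorter = s≤s (≤-trans (n≤1+n _) (≤-reflexive (sym (length-++-sucʳ l₁ u l₂))))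

parity-cong : ∀ (P : Node → Bool) {xs ys} → xs ~ ys → parity P xs ≡ parity P ys
parity-cong P {xs} {ys} e = begin
  parity P xs                                    ≡⟨ xor-identityʳ (parity P xs) ⟨
  parity P xs xor false                          ≡⟨ cong (parity P xs xor_) (parity-even P _ cancels) ⟨
  parity P xs xor parity P (xs ++ ys)            ≡⟨ cong (parity P xs xor_) (parity-++ P xs ys) ⟩
  parity P xs xor (parity P xs xor parity P ys)  ≡⟨ xor-cancelˡ (parity P xs) (parity P ys) ⟩
  parity P ys                                    ∎
  where
  open ≡-Reasoning
  cancels : xs ++ ys ~ []
  cancels = mk~ λ s →
    trans (odd-++ s xs ys) (trans (cong (_xor odd s ys) (odd-≡ e s)) (xor-same (odd s ys)))

map-cong-~ : ∀ (h : Node → Node) {xs ys} → xs ~ ys → map h xs ~ map h ys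
map-cong-~ h {xs} {ys} e = mk~ λ s → begin
  odd s (map h xs)              ≡⟨ odd≡parity s (map h xs) ⟩
  parity (s ==_) (map h xs)     ≡⟨ parity-map (s ==_) h xs ⟩
  parity ((s ==_) ∘ h) xs       ≡⟨ parity-cong ((s ==_) ∘ h) e ⟩
  parity ((s ==_) ∘ h) ys       ≡⟨ parity-map (s ==_) h ys ⟨
  parity (s ==_) (map h ys)     ≡⟨ odd≡parity s (map h ys) ⟨
  odd s (map h ys)              ∎
  where open ≡-Reasoning

++-cong-~ : ∀ {xs xs′ ys ys′} → xs ~ xs′ → ys ~ ys′ → xs ++ ys ~ xs′ ++ ys′
++-cong-~ {xs} {xs′} {ys} {ys′} e e′ = mk~ λ s →
  trans (odd-++ s xs ys) (trans (cong₂ _xor_ (odd-≡ e s) (odd-≡ e′ s)) (sym (odd-++ s xs′ ys′)))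

++-comm-~ : ∀ xs ys → xs ++ ys ~ ys ++ xs
++-comm-~ xs ys = mk~ λ s →
  trans (odd-++ s xs ys) (trans (xor-comm (odd s xs) (odd s ys)) (sym (odd-++ s ys xs)))

++-cancelˡ-~ : ∀ xs {ys zs} → xs ++ ys ~ xs ++ zs → ys ~ zs
++-cancelˡ-~ xs {ys} {zs} e = mk~ λ s → begin
  odd s ys                              ≡⟨ xor-cancelˡ (odd s xs) (odd s ys) ⟨
  odd s xs xor (odd s xs xor odd s ys)  ≡⟨ cong (odd s xs xor_) (sym (odd-++ s xs ys)) ⟩
  odd s xs xor odd s (xs ++ ys)         ≡⟨ cong (odd s xs xor_) (odd-≡ e s) ⟩
  odd s xs xor odd s (xs ++ zs)         ≡⟨ cong (odd s xs xor_) (odd-++ s xs zs) ⟩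
  odd s xs xor (odd s xs xor odd s zs)  ≡⟨ xor-cancelˡ (odd s xs) (odd s zs) ⟩
  odd s zs                              ∎
  where open ≡-Reasoning

++-cancelʳ-~ : ∀ {xs ys} zs → xs ++ zs ~ ys ++ zs → xs ~ ys
++-cancelʳ-~ {xs} {ys} zs e =
  ++-cancelˡ-~ zs (~-trans (++-comm-~ zs xs) (~-trans e (++-comm-~ ys zs)))

++-exchange-~ : ∀ as bs xs ys → as ++ ys ~ bs ++ xs → ys ~ xs ++ (as ++ bs)
++-exchange-~ as bs xs ys e = mk~ λ s → begin
  odd s ys                              ≡⟨ xor-exchange (odd s as) (odd s bs) _ _ (exchanged s) ⟩
  odd s xs xor (odd s as xor odd s bs)  ≡⟨ cong (odd s xs xor_) (sym (odd-++ s as bs)) ⟩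
  odd s xs xor odd s (as ++ bs)         ≡⟨ odd-++ s xs (as ++ bs) ⟨
  odd s (xs ++ (as ++ bs))              ∎
  where
  open ≡-Reasoning
  exchanged : ∀ s → odd s as xor odd s ys ≡ odd s bs xor odd s xs
  exchanged s = trans (sym (odd-++ s as ys)) (trans (odd-≡ e s) (odd-++ s bs xs))

-- The relation _≈_ of Defs, as a record for the same reason.
infix 4 _≋_
record _≋_ (x y : Elem) : Set where
  constructor mk≋
  field
    lvl-≡   : lvl x ≡ lvl y
    nodes-~ : nodes x ~ nodes y
open _≋_

≋⇔≈ : ∀ {x y} → x ≋ y ⇔ x ≈ y
≋⇔≈ = mk⇔ (λ e → lvl-≡ e , odd-≡ (nodes-~ e))
          (λ e → mk≋ (proj₁ e) (mk~ (proj₂ e)))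

≋-isEquivalence : IsEquivalence _≋_
≋-isEquivalence = record
  { refl  = mk≋ refl (mk~ λ _ → refl)
  ; sym   = λ e → mk≋ (sym (lvl-≡ e)) (~-sym (nodes-~ e))
  ; trans = λ e e′ → mk≋ (trans (lvl-≡ e) (lvl-≡ e′)) (~-trans (nodes-~ e) (nodes-~ e′))
  }

≋-setoid : Setoid 0ℓ 0ℓ
≋-setoid = record { isEquivalence = ≋-isEquivalence }

open IsEquivalence ≋-isEquivalence
  using () renaming (refl to ≋-refl; sym to ≋-sym; trans to ≋-trans; reflexive to ≋-reflexive)

module ≋-Reasoning = SetoidReasoning ≋-setoid

infixl 6 _⊕_
_⊕_ : Elem → Elem → Elem
x ⊕ y = mk (lvl x) (nodes x ++ nodes y)

⊕-cong : ∀ {x x′ y y′} → x ≋ x′ → y ≋ y′ → x ⊕ y ≋ x′ ⊕ y′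
⊕-cong e e′ = mk≋ (lvl-≡ e) (++-cong-~ (nodes-~ e) (nodes-~ e′))

⊕-cancelˡ : ∀ {x y y′} → lvl y ≡ lvl y′ → x ⊕ y ≋ x ⊕ y′ → y ≋ y′
⊕-cancelˡ {x} l e = mk≋ l (++-cancelˡ-~ (nodes x) (nodes-~ e))

⊕-cancelʳ : ∀ {x x′ y} → x ⊕ y ≋ x′ ⊕ y → x ≋ x′
⊕-cancelʳ {y = y} e = mk≋ (lvl-≡ e) (++-cancelʳ-~ (nodes y) (nodes-~ e))

p-lvl : ∀ x → lvl (p x) ≡ pred (lvl x)
p-lvl (mk zero          _) = refl
p-lvl (mk (suc zero)    _) = refl
p-lvl (mk (suc (suc n)) _) = refl

p-cong : ∀ {x y} → x ≋ y → p x ≋ p y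
p-cong {mk zero          _}  (mk≋ refl _) = ≋-refl
p-cong {mk (suc zero)    _}  (mk≋ refl _) = ≋-refl
p-cong {mk (suc (suc n)) xs} (mk≋ refl e) = mk≋ refl (map-cong-~ parent e)

p-⊕ : ∀ {x y} → lvl x ≡ lvl y → p (x ⊕ y) ≡ p x ⊕ p y
p-⊕ {mk zero          _}  refl = refl
p-⊕ {mk (suc zero)    _}  refl = refl
p-⊕ {mk (suc (suc n)) xs} {mk _ ys} refl = cong (mk (suc n)) (map-++ parent xs ys)

p-idE : ∀ n → p (idE n) ≡ idE (pred n)
p-idE zero          = refl
p-idE (suc zero)    = refl
p-idE (suc (suc n)) = refl

iter-lvl : ∀ j x → lvl (iter j x) ≡ lvl x ∸ j
iter-lvl zero    x = refl
iter-lvl (suc j) x =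
  trans (p-lvl (iter j x)) (trans (cong pred (iter-lvl j x)) (pred[m∸n]≡m∸[1+n] (lvl x) j))

iter-cong : ∀ j {x y} → x ≋ y → iter j x ≋ iter j y
iter-cong zero    e = e
iter-cong (suc j) e = p-cong (iter-cong j e)

iter-⊕ : ∀ j {x y} → lvl x ≡ lvl y → iter j (x ⊕ y) ≡ iter j x ⊕ iter j y
iter-⊕ zero    e = refl
iter-⊕ (suc j) {x} {y} e = trans (cong p (iter-⊕ j e)) (p-⊕ same-lvl)
  where
  same-lvl : lvl (iter j x) ≡ lvl (iter j y)
  same-lvl = trans (iter-lvl j x) (trans (cong (_∸ j) e) (sym (iter-lvl j y)))

iter-+ : ∀ i j x → iter i (iter j x) ≡ iter (i + j) x
iter-+ zero    j x = refl
iter-+ (suc i) j x = cong p (iter-+ i j x)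

iter-idE : ∀ j n → iter j (idE n) ≡ idE (n ∸ j)
iter-idE zero    n = refl
iter-idE (suc j) n =
  trans (cong p (iter-idE j n)) (trans (p-idE (n ∸ j)) (cong idE (pred[m∸n]≡m∸[1+n] n j)))

infixl 7 _↓_
_↓_ : Elem → ℕ → Elem
x ↓ m = iter (lvl x ∸ m) x

↓-lvl : ∀ {x m} → m ≤ lvl x → lvl (x ↓ m) ≡ m
↓-lvl {x} {m} m≤x = trans (iter-lvl (lvl x ∸ m) x) (m∸[m∸n]≡n m≤x)

↓-lvl-≤ : ∀ x m → lvl (x ↓ m) ≤ lvl x
↓-lvl-≤ x m = ≤-trans (≤-reflexive (iter-lvl (lvl x ∸ m) x)) (m∸n≤m (lvl x) (lvl x ∸ m))

↓-id : ∀ {x m} → lvl x ≤ m → x ↓ m ≡ x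
↓-id {x} x≤m = cong (λ j → iter j x) (m≤n⇒m∸n≡0 x≤m)

↓-cong : ∀ m {x y} → x ≋ y → x ↓ m ≋ y ↓ m
↓-cong m {x} {y} e =
  subst (λ l → x ↓ m ≋ iter (l ∸ m) y) (lvl-≡ e) (iter-cong (lvl x ∸ m) e)

↓-⊕ : ∀ m {x y} → lvl x ≡ lvl y → (x ⊕ y) ↓ m ≡ x ↓ m ⊕ y ↓ m
↓-⊕ m {x} {y} e = trans (iter-⊕ (lvl x ∸ m) e) (cong (λ l → x ↓ m ⊕ iter (l ∸ m) y) e)

↓-↓ : ∀ {x m m′} → m ≤ m′ → m′ ≤ lvl x → x ↓ m′ ↓ m ≡ x ↓ m
↓-↓ {x} {m} {m′} m≤m′ m′≤x = begin
  iter (lvl (x ↓ m′) ∸ m) (x ↓ m′)   ≡⟨ cong (λ l → iter (l ∸ m) (x ↓ m′)) (↓-lvl m′≤x) ⟩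
  iter (m′ ∸ m) (x ↓ m′)             ≡⟨ iter-+ (m′ ∸ m) (lvl x ∸ m′) x ⟩
  iter ((m′ ∸ m) + (lvl x ∸ m′)) x   ≡⟨ cong (λ j → iter j x) steps ⟩
  x ↓ m                              ∎
  where
  open ≡-Reasoning
  steps : (m′ ∸ m) + (lvl x ∸ m′) ≡ lvl x ∸ m
  steps = begin
    (m′ ∸ m) + (lvl x ∸ m′)    ≡⟨ +-comm (m′ ∸ m) (lvl x ∸ m′) ⟩
    (lvl x ∸ m′) + (m′ ∸ m)    ≡⟨ +-∸-assoc (lvl x ∸ m′) m≤m′ ⟨
    (lvl x ∸ m′ + m′) ∸ m      ≡⟨ cong (_∸ m) (m∸n+n≡m m′≤x) ⟩
    lvl x ∸ m                  ∎

idE-↓ : ∀ {m n} → m ≤ n → idE n ↓ m ≡ idE m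
idE-↓ {m} {n} m≤n = trans (iter-idE (n ∸ m) n) (cong idE (m∸[m∸n]≡n m≤n))

f-comm : ∀ a b → f a b ≋ f b a
f-comm a b = subst (λ m → f a b ≋ mk m (nodes (b ↓ m) ++ nodes (a ↓ m))) (⊓-comm (lvl a) (lvl b))
                   (mk≋ refl (++-comm-~ (nodes (a ↓ m)) (nodes (b ↓ m))))
  where
  m : ℕ
  m = lvl a ⊓ lvl b

f-cong₂ : ∀ a {b b′} → b ≋ b′ → f a b ≋ f a b′
f-cong₂ a {mk l bs} {mk _ bs′} (mk≋ refl e) =
  mk≋ refl (++-cong-~ (mk~ λ _ → refl) (nodes-~ (↓-cong (lvl a ⊓ l) (mk≋ refl e))))

f-below : ∀ {a b} → lvl b ≤ lvl a → f a b ≡ a ↓ lvl b ⊕ b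
f-below {a} {b} b≤a = begin
  f a b
    ≡⟨ cong (λ k → mk k (nodes (a ↓ k) ++ nodes (b ↓ k))) (m≥n⇒m⊓n≡n b≤a) ⟩
  mk (lvl b) (nodes (a ↓ lvl b) ++ nodes (b ↓ lvl b))
    ≡⟨ cong₂ (λ l z → mk l (nodes (a ↓ lvl b) ++ nodes z)) (sym (↓-lvl b≤a)) (↓-id {b} ≤-refl) ⟩
  a ↓ lvl b ⊕ b
    ∎
  where open ≡-Reasoning

f-idE : ∀ {m z} → lvl z ≤ m → f (idE m) z ≡ z
f-idE {z = z} z≤m = trans (f-below z≤m) (cong (_⊕ z) (idE-↓ z≤m))

f-idE-fixes : ∀ {m z} → lvl z ≤ m ⇔ f (idE m) z ≈ z
f-idE-fixes {m} {z} = mk⇔ (λ z≤m → to ≋⇔≈ (≋-reflexive (f-idE z≤m)))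
                          (λ e → subst (_≤ m) (proj₁ e) (m⊓n≤m m (lvl z)))

f-shift : ∀ a {z E} → lvl z ≤ lvl E → f a (z ⊕ E ↓ lvl z) ≡ f a z ⊕ E ↓ (lvl a ⊓ lvl z)
f-shift a {z} {E} z≤E = cong (mk m) (begin
  nodes (a ↓ m) ++ nodes ((z ⊕ E ↓ l) ↓ m)
    ≡⟨ cong (λ w → nodes (a ↓ m) ++ nodes w) (↓-⊕ m (sym (↓-lvl z≤E))) ⟩
  nodes (a ↓ m) ++ (nodes (z ↓ m) ++ nodes (E ↓ l ↓ m))
    ≡⟨ cong (λ w → nodes (a ↓ m) ++ (nodes (z ↓ m) ++ nodes w)) (↓-↓ (m⊓n≤n (lvl a) l) z≤E) ⟩
  nodes (a ↓ m) ++ (nodes (z ↓ m) ++ nodes (E ↓ m))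
    ≡⟨ ++-assoc (nodes (a ↓ m)) (nodes (z ↓ m)) (nodes (E ↓ m)) ⟨
  (nodes (a ↓ m) ++ nodes (z ↓ m)) ++ nodes (E ↓ m)
    ∎)
  where
  open ≡-Reasoning
  l : ℕ
  l = lvl z
  m : ℕ
  m = lvl a ⊓ l

record Shift (E x y : Elem) : Set where
  constructor mkShift
  field
    below : lvl x ≤ lvl E
    image : y ≋ x ⊕ E ↓ lvl x

shift-f : ∀ a {E z y} → Shift E z y → Shift E (f a z) (f a y)
shift-f a (mkShift z≤E e) =
  mkShift (≤-trans (m⊓n≤n (lvl a) _) z≤E)
          (≋-trans (f-cong₂ a e) (≋-reflexive (f-shift a z≤E)))

shift-≋ : ∀ {E x y x′ y′} → Shift E x y → Shift E x′ y′ → x ≋ x′ ⇔ y ≋ y′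
shift-≋ {E} {x} {y} {x′} {y′} (mkShift _ e) (mkShift _ e′) = mk⇔
  (λ x≋x′ → begin
    y               ≈⟨ e ⟩
    x ⊕ E ↓ lvl x   ≡⟨ cong (λ l → x ⊕ E ↓ l) (lvl-≡ x≋x′) ⟩
    x ⊕ E ↓ lvl x′  ≈⟨ ⊕-cong x≋x′ (≋-refl {E ↓ lvl x′}) ⟩
    x′ ⊕ E ↓ lvl x′ ≈⟨ ≋-sym e′ ⟩
    y′              ∎)
  (λ y≋y′ → let x⊕≋x′⊕ = ≋-trans (≋-sym e) (≋-trans y≋y′ e′) in ⊕-cancelʳ {y = E ↓ lvl x} (begin
    x ⊕ E ↓ lvl x   ≈⟨ x⊕≋x′⊕ ⟩
    x′ ⊕ E ↓ lvl x′ ≡⟨ cong (λ l → x′ ⊕ E ↓ l) (lvl-≡ x⊕≋x′⊕) ⟨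
    x′ ⊕ E ↓ lvl x  ∎))
  where open ≋-Reasoning

idE-shift : ∀ {E n} → lvl E ≡ n → Shift E (idE n) E
idE-shift {E} refl =
  mkShift ≤-refl (mk≋ refl (mk~ λ s → cong (odd s ∘ nodes) (sym (↓-id {E} ≤-refl))))

_⊑_ : Elem → Elem → Set
E ⊑ E′ = E ≋ E′ ↓ lvl E

⊑⇒lvl≤ : ∀ {E E′} → E ⊑ E′ → lvl E ≤ lvl E′
⊑⇒lvl≤ {E} {E′} e = subst (_≤ lvl E′) (sym (lvl-≡ e)) (↓-lvl-≤ E′ (lvl E))

shift-mono : ∀ {E E′ x y} → E ⊑ E′ → Shift E x y → Shift E′ x y
shift-mono {E} {E′} {x} {y} E⊑E′ (mkShift x≤E e) = mkShift (≤-trans x≤E (⊑⇒lvl≤ E⊑E′)) (begin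
  y                       ≈⟨ e ⟩
  x ⊕ E ↓ lvl x           ≈⟨ ⊕-cong ≋-refl (↓-cong (lvl x) E⊑E′) ⟩
  x ⊕ E′ ↓ lvl E ↓ lvl x  ≡⟨ cong (x ⊕_) (↓-↓ x≤E (⊑⇒lvl≤ E⊑E′)) ⟩
  x ⊕ E′ ↓ lvl x          ∎)
  where open ≋-Reasoning

shift-unique : ∀ {E E′ x y} → Shift E x y → Shift E′ x y → lvl x ≡ lvl E → E ⊑ E′
shift-unique {E} {E′} {x} (mkShift x≤E e) (mkShift x≤E′ e′) x≡E = begin
  E               ≡⟨ ↓-id ≤-refl ⟨
  E ↓ lvl E       ≡⟨ cong (E ↓_) (sym x≡E) ⟩
  E ↓ lvl x       ≈⟨ ⊕-cancelˡ (trans (↓-lvl x≤E) (sym (↓-lvl x≤E′))) (≋-trans (≋-sym e) e′) ⟩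
  E′ ↓ lvl x      ≡⟨ cong (E′ ↓_) x≡E ⟩
  E′ ↓ lvl E      ∎
  where open ≋-Reasoning

exchange⇒shift : ∀ {xᵢ yᵢ xⱼ yⱼ} → lvl yᵢ ≡ lvl xᵢ → lvl yⱼ ≡ lvl xⱼ → lvl xⱼ ≤ lvl xᵢ →
                 f xᵢ yⱼ ≋ f xⱼ yᵢ → Shift (f xᵢ yᵢ) xⱼ yⱼ
exchange⇒shift {xᵢ@(mk N _)} {yᵢ@(mk _ _)} {xⱼ@(mk l xs)} {yⱼ@(mk _ ys)} refl refl l≤N e =
  mkShift (⊓-glb l≤N l≤N) (mk≋ refl (subst (λ w → ys ~ xs ++ nodes w) (sym split)
    (++-exchange-~ (nodes (xᵢ ↓ l)) (nodes (yᵢ ↓ l)) xs ys (nodes-~ swapped))))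
  where
  swapped : xᵢ ↓ l ⊕ yⱼ ≋ yᵢ ↓ l ⊕ xⱼ
  swapped = begin
    xᵢ ↓ l ⊕ yⱼ  ≡⟨ f-below l≤N ⟨
    f xᵢ yⱼ      ≈⟨ e ⟩
    f xⱼ yᵢ      ≈⟨ f-comm xⱼ yᵢ ⟩
    f yᵢ xⱼ      ≡⟨ f-below l≤N ⟩
    yᵢ ↓ l ⊕ xⱼ  ∎
    where open ≋-Reasoning
  split : f xᵢ yᵢ ↓ l ≡ xᵢ ↓ l ⊕ yᵢ ↓ l
  split = begin
    f xᵢ yᵢ ↓ l              ≡⟨ cong (_↓ l) (f-below ≤-refl) ⟩
    (xᵢ ↓ N ⊕ yᵢ) ↓ l        ≡⟨ cong (λ x → (x ⊕ yᵢ) ↓ l) (↓-id {xᵢ} ≤-refl) ⟩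
    (xᵢ ⊕ yᵢ) ↓ l            ≡⟨ ↓-⊕ l refl ⟩
    xᵢ ↓ l ⊕ yᵢ ↓ l          ∎
    where open ≡-Reasoning

lookup-∷ʳ-inject₁ : ∀ (xs : Vec A k) x i → lookup (xs ∷ᵛ x) (inject₁ i) ≡ lookup xs i
lookup-∷ʳ-inject₁ (y ∷ xs) x zero    = refl
lookup-∷ʳ-inject₁ (y ∷ xs) x (suc i) = lookup-∷ʳ-inject₁ xs x i

lookup-∷ʳ-last : ∀ (xs : Vec A k) x → lookup (xs ∷ᵛ x) (fromℕ k) ≡ x
lookup-∷ʳ-last []       x = refl
lookup-∷ʳ-last (y ∷ xs) x = lookup-∷ʳ-last xs x

pointwise-∷ʳ⁺ : ∀ (R : A → B → Set) {xs : Vec A k} {ys x y} →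
                (∀ j → R (lookup xs j) (lookup ys j)) → R x y →
                ∀ j → R (lookup (xs ∷ᵛ x) j) (lookup (ys ∷ᵛ y) j)
pointwise-∷ʳ⁺ R {[]}     {[]}     _ r zero    = r
pointwise-∷ʳ⁺ R {_ ∷ _}  {_ ∷ _}  h r zero    = h zero
pointwise-∷ʳ⁺ R {_ ∷ xs} {_ ∷ ys} h r (suc j) = pointwise-∷ʳ⁺ R {xs} {ys} (h ∘ suc) r j

pointwise-∷ʳ⁻ : ∀ (R : A → B → Set) {xs : Vec A k} {ys x y} →
                (∀ j → R (lookup (xs ∷ᵛ x) j) (lookup (ys ∷ᵛ y) j)) →
                (∀ j → R (lookup xs j) (lookup ys j)) × R x y
pointwise-∷ʳ⁻ R {[]}     {[]}     h = (λ ()) , h zero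
pointwise-∷ʳ⁻ R {_ ∷ xs} {_ ∷ ys} h =
  let init , last = pointwise-∷ʳ⁻ R {xs} {ys} (h ∘ suc)
  in (λ { zero → h zero ; (suc j) → init j }) , last

all-∷ʳ⁺ : ∀ (P : A → Set) {xs : Vec A k} {x} →
          (∀ j → P (lookup xs j)) → P x → ∀ j → P (lookup (xs ∷ᵛ x) j)
all-∷ʳ⁺ P {xs} {x} = pointwise-∷ʳ⁺ (λ a _ → P a) {xs} {xs} {x} {x}

IsPeak : Vec Elem k → Fin k → Set
IsPeak xs i = ∀ j → lvl (lookup xs j) ≤ lvl (lookup xs i)

peak-∷ʳ-init : ∀ {xs : Vec Elem k} {i c} → IsPeak xs i → lvl c ≤ lvl (lookup xs i) →
               IsPeak (xs ∷ᵛ c) (inject₁ i)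
peak-∷ʳ-init {xs = xs} {i} {c} i-peak c≤i =
  subst (λ x → ∀ j → lvl (lookup (xs ∷ᵛ c) j) ≤ lvl x) (sym (lookup-∷ʳ-inject₁ xs c i))
        (all-∷ʳ⁺ (λ x → lvl x ≤ lvl (lookup xs i)) {xs} i-peak c≤i)

peak-∷ʳ-last : ∀ {xs : Vec Elem k} {c} → (∀ j → lvl (lookup xs j) ≤ lvl c) →
               IsPeak (xs ∷ᵛ c) (fromℕ k)
peak-∷ʳ-last {k} {xs} {c} below-c =
  subst (λ x → ∀ j → lvl (lookup (xs ∷ᵛ c) j) ≤ lvl x) (sym (lookup-∷ʳ-last xs c))
        (all-∷ʳ⁺ (λ x → lvl x ≤ lvl c) {xs} below-c ≤-refl)

peak-∷ʳ : ∀ {xs : Vec Elem k} {i} → IsPeak xs i → ∀ c → ∃[ m ] IsPeak (xs ∷ᵛ c) m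
peak-∷ʳ {k} {xs} {i} i-peak c with lvl c ≤? lvl (lookup xs i)
... | yes c≤i = inject₁ i , peak-∷ʳ-init {xs = xs} i-peak c≤i
... | no  c≰i = fromℕ k , peak-∷ʳ-last {xs = xs} (λ j → ≤-trans (i-peak j) (<⇒≤ (≰⇒> c≰i)))

record Peak (n : ℕ) (xs : Vec Elem k) : Set where
  constructor mkPeak
  field
    index  : Fin k
    isPeak : IsPeak xs index
    level  : lvl (lookup xs index) ≡ n

Shifts : Elem → Vec Elem k → Vec Elem k → Set
Shifts E xs ys = ∀ j → Shift E (lookup xs j) (lookup ys j)

≈-stable : ∀ x y → Stable (x ≈ y)
≈-stable x y ¬¬x≈y =
  decidable-stable (lvl x ≟ℕ lvl y) (¬¬-map proj₁ ¬¬x≈y) ,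
  λ s → decidable-stable (odd s (nodes x) ≟ᵇ odd s (nodes y)) (¬¬-map (λ e → proj₂ e s) ¬¬x≈y)

⇔-stable : ∀ {P Q : Set} → Stable P → Stable Q → Stable (P ⇔ Q)
⇔-stable P-stable Q-stable ¬¬P⇔Q =
  mk⇔ (λ p → Q-stable (¬¬-map (λ e → to e p) ¬¬P⇔Q))
      (λ q → P-stable (¬¬-map (λ e → from e q) ¬¬P⇔Q))

module _ (T : Node → Set) where

  AllValid : Vec Elem k → Set
  AllValid xs = ∀ j → Valid T (lookup xs j)

  idE-valid : ∀ n → Valid T (idE n)
  idE-valid n = [] , λ _ → refl

  AtomicEquiv : Vec Elem k → Vec Elem k → Set
  AtomicEquiv {k} xs ys = ∀ (t u : Term T k) → Sat xs (eq t u) ⇔ Sat ys (eq t u)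

  atomic-sym : ∀ {xs ys : Vec Elem k} → AtomicEquiv xs ys → AtomicEquiv ys xs
  atomic-sym ae t u = ⇔-sym (ae t u)

  atomic⇒sat : ∀ {xs ys : Vec Elem k} → AtomicEquiv xs ys → (φ : QF T k) → Sat xs φ ⇔ Sat ys φ
  atomic⇒sat ae (eq t u)  = ae t u
  atomic⇒sat ae (neg φ)   = ¬-cong-⇔ (atomic⇒sat ae φ)
  atomic⇒sat ae (and φ ψ) = atomic⇒sat ae φ ×-⇔ atomic⇒sat ae ψ
  atomic⇒sat ae (or φ ψ)  = atomic⇒sat ae φ ⊎-⇔ atomic⇒sat ae ψ

  atomic⇒BF0 : ∀ {xs ys : Vec Elem k} → AtomicEquiv xs ys → BF0 T xs ys
  atomic⇒BF0 ae φ = to (atomic⇒sat ae φ) , from (atomic⇒sat ae φ)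

  BF0⇒atomic : ∀ {xs ys : Vec Elem k} → BF0 T xs ys → AtomicEquiv xs ys
  BF0⇒atomic bf0 t u = mk⇔ (proj₁ (bf0 (eq t u))) (proj₂ (bf0 (eq t u)))

  atomic-stable : ∀ {xs ys : Vec Elem k} → Stable (AtomicEquiv xs ys)
  atomic-stable {xs = xs} {ys} ¬¬ae t u =
    ⇔-stable (≈-stable (eval xs t) (eval xs u)) (≈-stable (eval ys t) (eval ys u))
             (¬¬-map (λ ae → ae t u) ¬¬ae)

  weaken : Term T k → Term T (suc k)
  weaken (var i)      = var (inject₁ i)
  weaken (app a va t) = app a va (weaken t)

  eval-weaken : ∀ (xs : Vec Elem k) c (t : Term T k) → eval (xs ∷ᵛ c) (weaken t) ≡ eval xs t
  eval-weaken xs c (var i)      = lookup-∷ʳ-inject₁ xs c i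
  eval-weaken xs c (app a _ t) = cong (f a) (eval-weaken xs c t)

  atomic-∷ʳ⁻ : ∀ {xs ys : Vec Elem k} {c d} → AtomicEquiv (xs ∷ᵛ c) (ys ∷ᵛ d) → AtomicEquiv xs ys
  atomic-∷ʳ⁻ {xs = xs} {ys} {c} {d} ae t u
    rewrite sym (eval-weaken xs c t) | sym (eval-weaken xs c u)
          | sym (eval-weaken ys d t) | sym (eval-weaken ys d u) = ae (weaken t) (weaken u)

  shift-eval : ∀ {E} {xs ys : Vec Elem k} → Shifts E xs ys →
               (t : Term T k) → Shift E (eval xs t) (eval ys t)
  shift-eval               sh (var i)     = sh i
  shift-eval {xs = xs} {ys} sh (app a _ t) = shift-f a (shift-eval {xs = xs} {ys} sh t)

  shifts⇒atomic : ∀ {E} {xs ys : Vec Elem k} → Shifts E xs ys → AtomicEquiv xs ys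
  shifts⇒atomic {xs = xs} {ys} sh t u =
    ≋⇔≈ ⇔-∘ (shift-≋ (eval-shift t) (eval-shift u) ⇔-∘ ⇔-sym ≋⇔≈)
    where
    eval-shift = shift-eval {xs = xs} {ys} sh

  atomic⇒lvl≤ : ∀ {xs ys : Vec Elem k} → AtomicEquiv xs ys →
                ∀ j → lvl (lookup ys j) ≤ lvl (lookup xs j)
  atomic⇒lvl≤ {xs = xs} ae j =
    from f-idE-fixes (to (ae (app (idE l) (idE-valid l) (var j)) (var j)) (to f-idE-fixes ≤-refl))
    where
    l : ℕ
    l = lvl (lookup xs j)

  atomic⇒lvl≡ : ∀ {xs ys : Vec Elem k} → AtomicEquiv xs ys →
                ∀ j → lvl (lookup ys j) ≡ lvl (lookup xs j)
  atomic⇒lvl≡ ae j = ≤-antisym (atomic⇒lvl≤ ae j) (atomic⇒lvl≤ (atomic-sym ae) j)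

  atomic⇒f-lvl : ∀ {xs ys : Vec Elem k} → AtomicEquiv xs ys → ∀ i →
                 lvl (f (lookup xs i) (lookup ys i)) ≡ lvl (lookup xs i)
  atomic⇒f-lvl {xs = xs} ae i =
    trans (cong (lvl (lookup xs i) ⊓_) (atomic⇒lvl≡ ae i)) (⊓-idem (lvl (lookup xs i)))

  atomic⇒shifts : ∀ {xs ys : Vec Elem k} {i} → AllValid xs → AtomicEquiv xs ys → IsPeak xs i →
                  Shifts (f (lookup xs i) (lookup ys i)) xs ys
  atomic⇒shifts {xs = xs} {ys} {i} valid ae i-peak j =
    exchange⇒shift (atomic⇒lvl≡ ae i) (atomic⇒lvl≡ ae j) (i-peak j)
      (from ≋⇔≈ (to (ae fᵢⱼ fⱼᵢ) (to ≋⇔≈ (f-comm xᵢ xⱼ))))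
    where
    xᵢ xⱼ : Elem
    xᵢ = lookup xs i
    xⱼ = lookup xs j
    fᵢⱼ fⱼᵢ : Term T _
    fᵢⱼ = app xᵢ (valid i) (var j)
    fⱼᵢ = app xⱼ (valid j) (var i)

module _ (T : Node → Set) (O : Set) (_<_ : Rel O 0ℓ) where

  -- Whether β has predecessors is undecidable, so ≡^β only yields ¬ ¬ ≡^0 directly;
  -- atomic equivalence is stable, which removes the double negation.
  BF⇒¬¬atomic : ∀ {β} (a : Acc _<_ β) {xs ys : Vec Elem k} →
                BF T O _<_ β a xs ys → ¬ ¬ AtomicEquiv T xs ys
  BF⇒¬¬atomic {β = β} (acc rs) (bf0 , bf<) ¬ae = ¬ae (BF0⇒atomic T (bf0 minimal))
    where
    minimal : ∀ γ → ¬ γ < β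
    minimal γ γ<β =
      let _ , _ , bf = proj₁ (bf< γ γ<β) (idE 0) (idE-valid T 0)
      in BF⇒¬¬atomic (rs γ<β) bf (¬ae ∘ atomic-∷ʳ⁻ T)

  BF⇒atomic : ∀ {β} (a : Acc _<_ β) {xs ys : Vec Elem k} →
              BF T O _<_ β a xs ys → AtomicEquiv T xs ys
  BF⇒atomic a bf = atomic-stable T (BF⇒¬¬atomic a bf)

  Transfer : ∀ {β} → Acc _<_ β → Set
  Transfer {β} a = ∀ {k k′ E} {xs ys : Vec Elem k} {xs′ ys′ : Vec Elem k′} →
    AllValid T xs → Peak (lvl E) xs → Shifts E xs ys → Shifts E xs′ ys′ →
    BF T O _<_ β a xs ys → BF T O _<_ β a xs′ ys′

  transfer-step : ∀ {β} {a : Acc _<_ β} → Transfer a →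
                  ∀ {k k′ E} {xs ys : Vec Elem k} {xs′ ys′ : Vec Elem k′} {c d} →
                  AllValid T xs → Peak (lvl E) xs → Shifts E xs ys → Shifts E xs′ ys′ → Valid T c →
                  BF T O _<_ β a (xs ∷ᵛ c) (ys ∷ᵛ d) → BF T O _<_ β a (xs′ ∷ᵛ c) (ys′ ∷ᵛ d)
  transfer-step {a = a} transfer {k} {E = E} {xs} {ys} {xs′} {ys′} {c} {d}
                valid (mkPeak i i-peak i-lvl) sh sh′ c-valid bf =
    transfer valid⁺ (mkPeak m m-peak (sym (atomic⇒f-lvl T ae m))) sh⁺ sh′⁺ bf
    where
    valid⁺ : AllValid T (xs ∷ᵛ c)
    valid⁺ = all-∷ʳ⁺ (Valid T) {xs} valid c-valid
    ae : AtomicEquiv T (xs ∷ᵛ c) (ys ∷ᵛ d)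
    ae = BF⇒atomic a bf
    m : Fin (suc k)
    m = proj₁ (peak-∷ʳ {xs = xs} i-peak c)
    m-peak : IsPeak (xs ∷ᵛ c) m
    m-peak = proj₂ (peak-∷ʳ {xs = xs} i-peak c)
    E⁺ : Elem
    E⁺ = f (lookup (xs ∷ᵛ c) m) (lookup (ys ∷ᵛ d) m)
    sh⁺ : Shifts E⁺ (xs ∷ᵛ c) (ys ∷ᵛ d)
    sh⁺ = atomic⇒shifts T {xs = xs ∷ᵛ c} {ys ∷ᵛ d} valid⁺ ae m-peak
    sh⁺-init : Shifts E⁺ xs ys
    sh⁺-init = proj₁ (pointwise-∷ʳ⁻ (Shift E⁺) {xs} {ys} sh⁺)
    c↦d : Shift E⁺ c d
    c↦d = proj₂ (pointwise-∷ʳ⁻ (Shift E⁺) {xs} {ys} sh⁺)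
    E⊑E⁺ : E ⊑ E⁺
    E⊑E⁺ = shift-unique (sh i) (sh⁺-init i) i-lvl
    sh′⁺ : Shifts E⁺ (xs′ ∷ᵛ c) (ys′ ∷ᵛ d)
    sh′⁺ = pointwise-∷ʳ⁺ (Shift E⁺) {xs′} {ys′} (shift-mono E⊑E⁺ ∘ sh′) c↦d

  BF-transfer : ∀ {β} (a : Acc _<_ β) → Transfer a
  BF-transfer (acc rs) {xs′ = xs′} {ys′} valid peak sh sh′ (_ , bf<) =
    (λ _ → atomic⇒BF0 T (shifts⇒atomic T {xs = xs′} {ys′} sh′)) ,
    λ γ γ<β →
      let forth , back = bf< γ γ<β
          step = λ {c d} → transfer-step (BF-transfer (rs γ<β)) {c = c} {d} valid peak sh sh′
      in (λ c c-valid → let d , d-valid , bf = forth c c-valid in d , d-valid , step c-valid bf) ,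
         (λ d d-valid → let c , c-valid , bf = back d d-valid in c , c-valid , step c-valid bf)

lemma3p4 : (T : Node → Set) → IsTree T →
  {k : ℕ} (as bs : Vec Elem k) →
  (∀ j → Valid T (lookup as j)) → (∀ j → Valid T (lookup bs j)) →
  BF0 T as bs →
  (i : Fin k) → (∀ j → lvl (lookup as j) ≤ lvl (lookup as i)) →
  (O : Set) (_<_ : Rel O 0ℓ) → IsStrictTotalOrder _≡_ _<_ → (wf : WellFounded _<_) →
  (β : O) →
  let n = lvl (lookup as i)
      g = f (lookup as i) (lookup bs i)
  in (BF T O _<_ β (wf β) as bs ⇔ BF T O _<_ β (wf β) (as ∷ᵛ idE n) (bs ∷ᵛ g))
     × (BF T O _<_ β (wf β) (as ∷ᵛ idE n) (bs ∷ᵛ g) ⇔ BF T O _<_ β (wf β) [ idE n ] [ g ])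
lemma3p4 T _ as bs as-valid _ bf0 i i-peak O _<_ _ wf β =
  mk⇔ (transfer as-valid as-peak sh sh⁺) (transfer as⁺-valid as⁺-peak sh⁺ sh) ,
  mk⇔ (transfer as⁺-valid as⁺-peak sh⁺ sh₁) (transfer id-valid id-peak sh₁ sh⁺)
  where
  n : ℕ
  n = lvl (lookup as i)
  g : Elem
  g = f (lookup as i) (lookup bs i)
  transfer : Transfer T O _<_ (wf β)
  transfer = BF-transfer T O _<_ (wf β)
  ae : AtomicEquiv T as bs
  ae = BF0⇒atomic T bf0
  g-lvl : lvl g ≡ n
  g-lvl = atomic⇒f-lvl T ae i
  sh : Shifts g as bs
  sh = atomic⇒shifts T as-valid ae i-peak
  sh⁺ : Shifts g (as ∷ᵛ idE n) (bs ∷ᵛ g)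
  sh⁺ = pointwise-∷ʳ⁺ (Shift g) {as} {bs} sh (idE-shift g-lvl)
  sh₁ : Shifts g [ idE n ] [ g ]
  sh₁ zero = idE-shift g-lvl
  as⁺-valid : AllValid T (as ∷ᵛ idE n)
  as⁺-valid = all-∷ʳ⁺ (Valid T) {as} as-valid (idE-valid T n)
  id-valid : AllValid T [ idE n ]
  id-valid zero = idE-valid T n
  as-peak : Peak (lvl g) as
  as-peak = mkPeak i i-peak (sym g-lvl)
  as⁺-peak : Peak (lvl g) (as ∷ᵛ idE n)
  as⁺-peak = mkPeak (inject₁ i) (peak-∷ʳ-init {xs = as} i-peak ≤-refl)
                    (trans (cong lvl (lookup-∷ʳ-inject₁ as (idE n) i)) (sym g-lvl))
  id-peak : Peak (lvl g) [ idE n ]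
  id-peak = mkPeak zero (λ { zero → ≤-refl }) (sym g-lvl)
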